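{- Let $k \ge 3$ be an integer. Consider any instance of the online transportation problem in which every server site has capacity $a_j = 1$ for the optimal (offline) solution and capacity $c_j = k$ for the online algorithm. Then $\mathrm{GREEDY}_k(I) \le \left(1 + \frac{2}{k-2}\right)\mathrm{OPT}(I)$.
   Context: Online transportation problem: a metric space $\mathcal{M}$ with distance $d$ contains server sites $s_1,\dots,s_m$; requests $r_1,\dots,r_n$ arrive one at a time at locations in $\mathcal{M}$. $\mathrm{OPT}(I)$ is the minimum total request-to-site distance over all assignments in which each site receives at most $a_j$ requests. $\mathrm{GREEDY}$ assigns each arriving request irrevocably to a nearest site that is not yet full (ties broken arbitrarily). $\mathrm{GREEDY}_k(I)$ is the total distance incurred by $\mathrm{GREEDY}$ when site $s_j$ has capacity $c_j$ (here $c_j = k$).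
   Formalization: The distance $d$ of the metric space $\mathcal{M}$ takes values in the rationals. -}

module Defs where

open import Data.Nat as ℕ using (ℕ; zero; suc; _<_; _<?_)
open import Data.Fin using (Fin; toℕ; zero; suc)
open import Data.Fin.Properties using (_≟_)
open import Data.List using (List; length; filter; allFin)
open import Data.Product using (_×_)
open import Relation.Nullary.Decidable using (_×-dec_)
open import Relation.Binary.PropositionalEquality using (_≡_)
open import Data.Rational using (ℚ; 0ℚ; _+_; _≤_)

record Metric (M : Set) : Set where
  field
    d          : M → M → ℚ
    d-self     : ∀ x → d x x ≡ 0ℚ
    d-zero     : ∀ x y → d x y ≡ 0ℚ → x ≡ y
    d-nonneg   : ∀ x y → 0ℚ ≤ d x y
    d-sym      : ∀ x y → d x y ≡ d y x
    d-triangle : ∀ x y z → d x z ≤ d x y + d y z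

∑ : ∀ {n} → (Fin n → ℚ) → ℚ
∑ {zero}  f = 0ℚ
∑ {suc n} f = f zero + ∑ (λ i → f (suc i))

module _ {M : Set} (μ : Metric M) {m n : ℕ}
         (s : Fin m → M)
         (r : Fin n → M)   -- requests r_1..r_n, in arrival order
         where
  open Metric μ

  cost : (Fin n → Fin m) → ℚ
  cost σ = ∑ (λ i → d (r i) (s (σ i)))

  loadBefore : (Fin n → Fin m) → Fin n → Fin m → ℕ
  loadBefore g i j =
    length (filter (λ i' → (toℕ i' <? toℕ i) ×-dec (g i' ≟ j)) (allFin n))

  -- g is a possible run of GREEDY with every site of capacity k (any tie-breaking):
  -- each request goes to a site not yet full, and that site is at least as
  -- close as every site not yet full at its arrival.
  IsGreedyRun : ℕ → (Fin n → Fin m) → Set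
  IsGreedyRun k g = ∀ i →
    (loadBefore g i (g i) < k) ×
    (∀ j → loadBefore g i j < k → d (r i) (s (g i)) ≤ d (r i) (s j))

-- Call a site open if GREEDY leaves it with fewer than k requests, and let E j be
-- the distance from s j to the open site nearest to it.  An open site is never
-- full, so request i could have gone to the open site nearest its offline site
-- σ i: greedy i ≤ opt i + E (σ i).  A site j that is not open received k
-- requests, and for each of them the open site nearest σ i is within
-- greedy i + opt i + E (σ i) of s j, so k E j is at most the sum of these
-- quantities over the requests served at j.  Summing (σ injective) gives
-- GREEDY ≤ OPT + ΣE and k ΣE ≤ GREEDY + OPT + ΣE, hence (k - 2) GREEDY ≤ k OPT.
module Submission where

open import Defs
open import Data.Nat using (ℕ; _∸_; _≤_)
open import Data.Fin using (Fin)
open import Function.Definitions using (Injective)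
open import Relation.Binary.PropositionalEquality using (_≡_)
open import Data.Rational using (ℚ; _*_; _/_) renaming (_≤_ to _≤ℚ_)
open import Data.Integer using (+_)

open import Algebra.Bundles using (CommutativeMonoid)
open import Data.Bool using (if_then_else_)
open import Data.Fin using (zero; suc; toℕ)
open import Data.Fin.Properties using (_≟_; any?; suc-injective; 0≢1+n)
import Data.Integer as ℤ
import Data.Integer.Properties as ℤ
open import Data.List using (List; length; filter; tabulate; allFin)
open import Data.List.Membership.Propositional.Properties using (∈-filter⁺; ∈-allFin)
open import Data.List.Relation.Binary.Sublist.Propositional using (⊆-refl)
open import Data.List.Relation.Binary.Sublist.Propositional.Properties using (filter⁺; length-mono-≤)
import Data.List.Relation.Unary.All as All
open import Data.List.Relation.Unary.All.Properties using (all-filter)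
open import Data.Nat using (zero; suc; _<_; s≤s; _<?_)
import Data.Nat as ℕ
import Data.Nat.Properties as ℕ
open import Data.Nat.Coprimality using (1-coprimeTo) renaming (sym to coprime-sym)
open import Data.Product using (∃; _,_; proj₂)
open import Data.Rational using (0ℚ; 1ℚ; _+_; -_)
import Data.Rational.Properties as ℚ
open import Function using (_∘_)
open import Relation.Binary.Bundles using (DecTotalOrder)
open import Relation.Binary.PropositionalEquality using (refl; sym; cong; cong₂; subst)
open import Relation.Nullary using (Dec; does; yes; no; ¬_; contradiction)
open import Relation.Nullary.Decidable using (_×-dec_)
open import Relation.Unary using (Decidable)

open import Algebra.Properties.Group ℚ.+-0-group using (\\-leftDividesʳ)
open import Algebra.Properties.CommutativeSemigroup
  (CommutativeMonoid.commutativeSemigroup ℚ.+-0-commutativeMonoid) using (interchange)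
open import Algebra.Properties.CommutativeMonoid.Mult ℚ.+-0-commutativeMonoid
  using (_×_; ×-distrib-+)
open import Data.List.Extrema (DecTotalOrder.totalOrder ℚ.≤-decTotalOrder)
  using (argmin; argmin-all; f[argmin]≤f[xs])

open ℚ.≤-Reasoning

p≤q+p : ∀ {p q} → 0ℚ ≤ℚ q → p ≤ℚ q + p
p≤q+p {p} {q} 0≤q = begin
  p       ≡⟨ ℚ.+-identityˡ p ⟨
  0ℚ + p  ≤⟨ ℚ.+-monoˡ-≤ p 0≤q ⟩
  q + p   ∎

p≤p+q : ∀ {p q} → 0ℚ ≤ℚ q → p ≤ℚ p + q
p≤p+q {p} {q} 0≤q = subst (p ≤ℚ_) (ℚ.+-comm q p) (p≤q+p 0≤q)

+-nonneg : ∀ {p q} → 0ℚ ≤ℚ p → 0ℚ ≤ℚ q → 0ℚ ≤ℚ p + q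
+-nonneg 0≤p 0≤q = ℚ.≤-trans 0≤q (p≤q+p 0≤p)

+-cancelˡ-≤ : ∀ p {q r} → p + q ≤ℚ p + r → q ≤ℚ r
+-cancelˡ-≤ p {q} {r} p+q≤p+r = begin
  q              ≡⟨ \\-leftDividesʳ p q ⟨
  - p + (p + q)  ≤⟨ ℚ.+-monoʳ-≤ (- p) p+q≤p+r ⟩
  - p + (p + r)  ≡⟨ \\-leftDividesʳ p r ⟩
  r              ∎

×-monoʳ-≤ : ∀ k {p q} → p ≤ℚ q → k × p ≤ℚ k × q
×-monoʳ-≤ zero    p≤q = ℚ.≤-refl
×-monoʳ-≤ (suc k) p≤q = ℚ.+-mono-≤ p≤q (×-monoʳ-≤ k p≤q)

×-zeroʳ : ∀ k → k × 0ℚ ≡ 0ℚ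
×-zeroʳ zero    = refl
×-zeroʳ (suc k) = cong (_+_ 0ℚ) (×-zeroʳ k)

-- (+ k) / 1 is normalize k 1, which does not compute for a variable k until
-- normalize-coprime turns it into mkℚ (+ k) 0 _.
+[1+k]/1≡1+k/1 : ∀ k → + suc k / 1 ≡ 1ℚ + + k / 1
+[1+k]/1≡1+k/1 k rewrite ℚ.normalize-coprime {k} {0} (coprime-sym (1-coprimeTo k)) =
  cong (_/ 1) (cong (ℤ._+_ (+ 1)) (sym (ℤ.*-identityʳ (+ k))))

k/1*p≡k×p : ∀ k p → (+ k / 1) * p ≡ k × p
k/1*p≡k×p zero    p = ℚ.*-zeroˡ p
k/1*p≡k×p (suc k) p = begin-equality
  (+ suc k / 1) * p       ≡⟨ cong (_* p) (+[1+k]/1≡1+k/1 k) ⟩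
  (1ℚ + + k / 1) * p      ≡⟨ ℚ.*-distribʳ-+ p 1ℚ (+ k / 1) ⟩
  1ℚ * p + (+ k / 1) * p  ≡⟨ cong₂ _+_ (ℚ.*-identityˡ p) (k/1*p≡k×p k p) ⟩
  p + k × p               ∎

ratio-bound : ∀ K {X Y Z} → X ≤ℚ Y + Z → suc (suc K) × Z ≤ℚ X + Y + Z →
              K × X ≤ℚ suc (suc K) × Y
ratio-bound K {X} {Y} {Z} X≤Y+Z [2+K]Z≤X+Y+Z = +-cancelˡ-≤ X (begin
  suc K × X              ≤⟨ ×-monoʳ-≤ (suc K) X≤Y+Z ⟩
  suc K × (Y + Z)        ≡⟨ ×-distrib-+ Y Z (suc K) ⟩
  suc K × Y + suc K × Z  ≤⟨ ℚ.+-monoʳ-≤ (suc K × Y) [1+K]Z≤X+Y ⟩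
  suc K × Y + (X + Y)    ≡⟨ ℚ.+-comm (suc K × Y) (X + Y) ⟩
  X + Y + suc K × Y      ≡⟨ ℚ.+-assoc X Y (suc K × Y) ⟩
  X + suc (suc K) × Y    ∎)
  where
  [1+K]Z≤X+Y : suc K × Z ≤ℚ X + Y
  [1+K]Z≤X+Y = +-cancelˡ-≤ Z (begin
    Z + suc K × Z  ≤⟨ [2+K]Z≤X+Y+Z ⟩
    X + Y + Z      ≡⟨ ℚ.+-comm (X + Y) Z ⟩
    Z + (X + Y)    ∎)

∑-cong : ∀ {n} {f g : Fin n → ℚ} → (∀ i → f i ≡ g i) → ∑ f ≡ ∑ g
∑-cong {zero}  f≗g = refl
∑-cong {suc n} f≗g = cong₂ _+_ (f≗g zero) (∑-cong (f≗g ∘ suc))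

∑-mono-≤ : ∀ {n} {f g : Fin n → ℚ} → (∀ i → f i ≤ℚ g i) → ∑ f ≤ℚ ∑ g
∑-mono-≤ {zero}  f≤g = ℚ.≤-refl
∑-mono-≤ {suc n} f≤g = ℚ.+-mono-≤ (f≤g zero) (∑-mono-≤ (f≤g ∘ suc))

∑-zero : ∀ {n} {f : Fin n → ℚ} → (∀ i → f i ≡ 0ℚ) → ∑ f ≡ 0ℚ
∑-zero {zero}  f≗0 = refl
∑-zero {suc n} f≗0 = cong₂ _+_ (f≗0 zero) (∑-zero (f≗0 ∘ suc))

∑-nonneg : ∀ {n} {f : Fin n → ℚ} → (∀ i → 0ℚ ≤ℚ f i) → 0ℚ ≤ℚ ∑ f
∑-nonneg {zero}  0≤f = ℚ.≤-refl
∑-nonneg {suc n} 0≤f = +-nonneg (0≤f zero) (∑-nonneg (0≤f ∘ suc))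

term≤∑ : ∀ {n} {f : Fin n → ℚ} → (∀ i → 0ℚ ≤ℚ f i) → ∀ i → f i ≤ℚ ∑ f
term≤∑ {suc n} 0≤f zero    = p≤p+q (∑-nonneg (0≤f ∘ suc))
term≤∑ {suc n} 0≤f (suc i) = ℚ.≤-trans (term≤∑ (0≤f ∘ suc) i) (p≤q+p (0≤f zero))

∑-+ : ∀ {n} (f g : Fin n → ℚ) → ∑ (λ i → f i + g i) ≡ ∑ f + ∑ g
∑-+ {zero}  f g = refl
∑-+ {suc n} f g = begin-equality
  f₀ + g₀ + ∑ (λ i → f (suc i) + g (suc i))  ≡⟨ cong (_+_ (f₀ + g₀)) (∑-+ (f ∘ suc) (g ∘ suc)) ⟩
  f₀ + g₀ + (∑ (f ∘ suc) + ∑ (g ∘ suc))      ≡⟨ interchange f₀ g₀ (∑ (f ∘ suc)) (∑ (g ∘ suc)) ⟩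
  f₀ + ∑ (f ∘ suc) + (g₀ + ∑ (g ∘ suc))      ∎
  where f₀ = f zero; g₀ = g zero

∑-comm : ∀ {m n} (F : Fin n → Fin m → ℚ) → ∑ (λ j → ∑ (λ i → F i j)) ≡ ∑ (λ i → ∑ (F i))
∑-comm {zero}  {n} F = sym (∑-zero {n} (λ _ → refl))
∑-comm {suc m}     F = begin-equality
  ∑ F₀ + ∑ (λ j → ∑ (λ i → F i (suc j)))  ≡⟨ cong (_+_ (∑ F₀)) (∑-comm (λ i → F i ∘ suc)) ⟩
  ∑ F₀ + ∑ (λ i → ∑ (F i ∘ suc))          ≡⟨ ∑-+ F₀ (λ i → ∑ (F i ∘ suc)) ⟨
  ∑ (λ i → ∑ (F i))                       ∎
  where F₀ = λ i → F i zero

∑-× : ∀ {n} k (f : Fin n → ℚ) → ∑ (λ i → k × f i) ≡ k × ∑ f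
∑-× {zero}  k f = sym (×-zeroʳ k)
∑-× {suc n} k f = begin-equality
  k × f zero + ∑ (λ i → k × f (suc i))  ≡⟨ cong (_+_ (k × f zero)) (∑-× k (f ∘ suc)) ⟩
  k × f zero + k × ∑ (f ∘ suc)          ≡⟨ ×-distrib-+ (f zero) (∑ (f ∘ suc)) k ⟨
  k × ∑ f                               ∎

when : {P : Set} → Dec P → ℚ → ℚ
when P? p = if does P? then p else 0ℚ

when-nonneg : ∀ {P : Set} (P? : Dec P) {p} → 0ℚ ≤ℚ p → 0ℚ ≤ℚ when P? p
when-nonneg (yes _) 0≤p = 0≤p
when-nonneg (no _)  _   = ℚ.≤-refl

when-¬ : ∀ {P : Set} (P? : Dec P) {p} → ¬ P → when P? p ≡ 0ℚ
when-¬ (yes x) ¬x = contradiction x ¬x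
when-¬ (no _)  _  = refl

∑-when-≟ : ∀ {m} (x : Fin m) p → ∑ (λ j → when (x ≟ j) p) ≡ p
∑-when-≟ {suc m} zero    p = begin-equality
  p + ∑ {m} (λ _ → 0ℚ)  ≡⟨ cong (_+_ p) (∑-zero {m} (λ _ → refl)) ⟩
  p + 0ℚ                ≡⟨ ℚ.+-identityʳ p ⟩
  p                     ∎
∑-when-≟ {suc m} (suc x) p = begin-equality
  0ℚ + ∑ (λ j → when (x ≟ j) p)  ≡⟨ ℚ.+-identityˡ _ ⟩
  ∑ (λ j → when (x ≟ j) p)       ≡⟨ ∑-when-≟ x p ⟩
  p                              ∎

×-≤-∑-when : ∀ {A : Set} {P : A → Set} (P? : Decidable P) {n} (f : Fin n → A)
             {h : Fin n → ℚ} {c} k → k ≤ length (filter P? (tabulate f)) →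
             (∀ i → 0ℚ ≤ℚ h i) → (∀ i → P (f i) → c ≤ℚ h i) →
             k × c ≤ℚ ∑ (λ i → when (P? (f i)) (h i))
×-≤-∑-when P? f zero _ 0≤h _ = ∑-nonneg (λ i → when-nonneg (P? (f i)) (0≤h i))
×-≤-∑-when P? {suc n} f (suc k) k<len 0≤h c≤h with P? (f zero)
... | yes Pf₀ = ℚ.+-mono-≤ (c≤h zero Pf₀)
                  (×-≤-∑-when P? (f ∘ suc) k (ℕ.s≤s⁻¹ k<len) (0≤h ∘ suc) (c≤h ∘ suc))
... | no _    = ℚ.≤-trans (×-≤-∑-when P? (f ∘ suc) (suc k) k<len (0≤h ∘ suc) (c≤h ∘ suc))
                          (p≤q+p ℚ.≤-refl)

fibreSum : ∀ {m n} → (Fin n → Fin m) → (Fin n → ℚ) → Fin m → ℚ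
fibreSum f h j = ∑ (λ i → when (f i ≟ j) (h i))

∑-fibreSum : ∀ {m n} (f : Fin n → Fin m) (h : Fin n → ℚ) → ∑ (fibreSum f h) ≡ ∑ h
∑-fibreSum f h = begin-equality
  ∑ (λ j → ∑ (λ i → when (f i ≟ j) (h i)))  ≡⟨ ∑-comm (λ i j → when (f i ≟ j) (h i)) ⟩
  ∑ (λ i → ∑ (λ j → when (f i ≟ j) (h i)))  ≡⟨ ∑-cong (λ i → ∑-when-≟ (f i) (h i)) ⟩
  ∑ h                                       ∎

fibreSum-injective-≤ : ∀ {m n} {σ : Fin n → Fin m} → Injective _≡_ _≡_ σ →
                       ∀ {E : Fin m → ℚ} {j} → 0ℚ ≤ℚ E j → fibreSum σ (E ∘ σ) j ≤ℚ E j
fibreSum-injective-≤ {n = zero} σ-inj 0≤Ej = 0≤Ej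
fibreSum-injective-≤ {n = suc n} {σ} σ-inj {E} {j} 0≤Ej with σ zero ≟ j
... | yes refl = ℚ.≤-reflexive (begin-equality
  E (σ zero) + fibreSum (σ ∘ suc) (E ∘ σ ∘ suc) (σ zero)  ≡⟨ cong (_+_ (E (σ zero))) rest-empty ⟩
  E (σ zero) + 0ℚ                                        ≡⟨ ℚ.+-identityʳ (E (σ zero)) ⟩
  E (σ zero)                                             ∎)
  where
  rest-empty : fibreSum (σ ∘ suc) (E ∘ σ ∘ suc) (σ zero) ≡ 0ℚ
  rest-empty = ∑-zero (λ i → when-¬ (σ (suc i) ≟ σ zero) (0≢1+n ∘ sym ∘ σ-inj))
... | no _ = begin
  0ℚ + fibreSum (σ ∘ suc) (E ∘ σ ∘ suc) j  ≡⟨ ℚ.+-identityˡ _ ⟩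
  fibreSum (σ ∘ suc) (E ∘ σ ∘ suc) j       ≤⟨ fibreSum-injective-≤ (suc-injective ∘ σ-inj) 0≤Ej ⟩
  E j                                      ∎

∑-∘-injective-≤ : ∀ {m n} {σ : Fin n → Fin m} → Injective _≡_ _≡_ σ →
                  ∀ {E : Fin m → ℚ} → (∀ j → 0ℚ ≤ℚ E j) → ∑ (E ∘ σ) ≤ℚ ∑ E
∑-∘-injective-≤ {σ = σ} σ-inj {E} 0≤E = begin
  ∑ (E ∘ σ)               ≡⟨ ∑-fibreSum σ (E ∘ σ) ⟨
  ∑ (fibreSum σ (E ∘ σ))  ≤⟨ ∑-mono-≤ (λ j → fibreSum-injective-≤ σ-inj (0≤E j)) ⟩
  ∑ E                     ∎

module Charging {M : Set} (μ : Metric M) {m n : ℕ} (s : Fin m → M) (r : Fin n → M)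
                (k : ℕ) (g σ : Fin n → Fin m) where
  open Metric μ

  greedyCost optCost : Fin n → ℚ
  greedyCost i = d (r i) (s (g i))
  optCost    i = d (r i) (s (σ i))

  load : Fin m → ℕ
  load j = length (filter (λ i → g i ≟ j) (allFin n))

  Open : Fin m → Set
  Open j = load j < k

  loadBefore≤load : ∀ i j → loadBefore μ s r g i j ≤ load j
  loadBefore≤load i j =
    length-mono-≤ (filter⁺ earlier? (λ i′ → g i′ ≟ j) (λ { refl → proj₂ }) (⊆-refl {x = allFin n}))
    where earlier? = λ i′ → (toℕ i′ <? toℕ i) ×-dec (g i′ ≟ j)

  ×-≤-fibreSum : ∀ {j h c} → k ≤ load j → (∀ i → 0ℚ ≤ℚ h i) → (∀ i → g i ≡ j → c ≤ℚ h i) →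
                 k × c ≤ℚ fibreSum g h j
  ×-≤-fibreSum {j} = ×-≤-∑-when (λ i → g i ≟ j) (λ i → i) k

  -- For the potential E built below, the length of the path from s (g i) via r i
  -- and s (σ i) to the open site nearest σ i.
  detour : (Fin m → ℚ) → Fin n → ℚ
  detour E i = greedyCost i + optCost i + E (σ i)

  detour-nonneg : ∀ {E} → (∀ j → 0ℚ ≤ℚ E j) → ∀ i → 0ℚ ≤ℚ detour E i
  detour-nonneg 0≤E i = +-nonneg (+-nonneg (d-nonneg _ _) (d-nonneg _ _)) (0≤E (σ i))

  record Potential (E : Fin m → ℚ) : Set where
    field
      nonneg  : ∀ j → 0ℚ ≤ℚ E j
      covers  : ∀ i → greedyCost i ≤ℚ optCost i + E (σ i)
      charges : ∀ j → k × E j ≤ℚ fibreSum g (detour E) j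

  module _ (σ-inj : Injective _≡_ _≡_ σ) {E : Fin m → ℚ} (E-pot : Potential E) where
    open Potential E-pot

    ∑∘σ≤∑ : ∑ (E ∘ σ) ≤ℚ ∑ E
    ∑∘σ≤∑ = ∑-∘-injective-≤ σ-inj nonneg

    ∑greedy≤∑opt+∑ : ∑ greedyCost ≤ℚ ∑ optCost + ∑ E
    ∑greedy≤∑opt+∑ = begin
      ∑ greedyCost                   ≤⟨ ∑-mono-≤ covers ⟩
      ∑ (λ i → optCost i + E (σ i))  ≡⟨ ∑-+ optCost (E ∘ σ) ⟩
      ∑ optCost + ∑ (E ∘ σ)          ≤⟨ ℚ.+-monoʳ-≤ (∑ optCost) ∑∘σ≤∑ ⟩
      ∑ optCost + ∑ E                ∎

    k×∑≤∑greedy+∑opt+∑ : k × ∑ E ≤ℚ ∑ greedyCost + ∑ optCost + ∑ E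
    k×∑≤∑greedy+∑opt+∑ = begin
      k × ∑ E                                         ≡⟨ ∑-× k E ⟨
      ∑ (λ j → k × E j)                               ≤⟨ ∑-mono-≤ charges ⟩
      ∑ (fibreSum g (detour E))                       ≡⟨ ∑-fibreSum g (detour E) ⟩
      ∑ (detour E)                                    ≡⟨ ∑-+ (λ i → greedyCost i + optCost i) (E ∘ σ) ⟩
      ∑ (λ i → greedyCost i + optCost i) + ∑ (E ∘ σ)  ≡⟨ cong (_+ ∑ (E ∘ σ)) (∑-+ greedyCost optCost) ⟩
      ∑ greedyCost + ∑ optCost + ∑ (E ∘ σ)            ≤⟨ ℚ.+-monoʳ-≤ (∑ greedyCost + ∑ optCost) ∑∘σ≤∑ ⟩
      ∑ greedyCost + ∑ optCost + ∑ E                  ∎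

  -- If no site is open (which forces m = n = 0), a large enough constant is a potential.
  saturated-potential : (∀ j → k ≤ load j) → Potential (λ _ → ∑ greedyCost)
  saturated-potential saturated = record
    { nonneg  = λ _ → ∑greedy-nonneg
    ; covers  = λ i → ℚ.≤-trans (term≤∑ greedy-nonneg i) (p≤q+p (d-nonneg _ _))
    ; charges = λ j → ×-≤-fibreSum (saturated j) (detour-nonneg (λ _ → ∑greedy-nonneg))
                        (λ i _ → p≤q+p (+-nonneg (d-nonneg _ _) (d-nonneg _ _)))
    }
    where
    greedy-nonneg : ∀ i → 0ℚ ≤ℚ greedyCost i
    greedy-nonneg i = d-nonneg _ _
    ∑greedy-nonneg : 0ℚ ≤ℚ ∑ greedyCost
    ∑greedy-nonneg = ∑-nonneg greedy-nonneg

  module NearestOpen (greedy : IsGreedyRun μ s r k g) (j₀ : Fin m) (j₀-open : Open j₀) where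

    opens : List (Fin m)
    opens = filter (λ j → load j <? k) (allFin m)

    nearestOpen : Fin m → Fin m
    nearestOpen j = argmin (λ j′ → d (s j) (s j′)) j₀ opens

    distToOpen : Fin m → ℚ
    distToOpen j = d (s j) (s (nearestOpen j))

    distToOpen-nonneg : ∀ j → 0ℚ ≤ℚ distToOpen j
    distToOpen-nonneg j = d-nonneg (s j) (s (nearestOpen j))

    nearestOpen-open : ∀ j → Open (nearestOpen j)
    nearestOpen-open j =
      argmin-all (λ j′ → d (s j) (s j′)) j₀-open (all-filter (λ j → load j <? k) (allFin m))

    distToOpen-≤ : ∀ j {j′} → Open j′ → distToOpen j ≤ℚ d (s j) (s j′)
    distToOpen-≤ j {j′} j′-open =
      All.lookup (f[argmin]≤f[xs] j₀ opens) (∈-filter⁺ (λ j → load j <? k) (∈-allFin j′) j′-open)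

    reach : ∀ i → d (r i) (s (nearestOpen (σ i))) ≤ℚ optCost i + distToOpen (σ i)
    reach i = d-triangle (r i) (s (σ i)) (s (nearestOpen (σ i)))

    -- nearestOpen (σ i) is open at the end, so it was not full when request i arrived.
    covers : ∀ i → greedyCost i ≤ℚ optCost i + distToOpen (σ i)
    covers i = ℚ.≤-trans
      (proj₂ (greedy i) (nearestOpen (σ i))
        (ℕ.≤-<-trans (loadBefore≤load i (nearestOpen (σ i))) (nearestOpen-open (σ i))))
      (reach i)

    distToOpen-≤-detour : ∀ i → distToOpen (g i) ≤ℚ detour distToOpen i
    distToOpen-≤-detour i = begin
      distToOpen (g i)                                     ≤⟨ distToOpen-≤ (g i) (nearestOpen-open (σ i)) ⟩
      d (s (g i)) (s (nearestOpen (σ i)))                  ≤⟨ d-triangle (s (g i)) (r i) _ ⟩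
      d (s (g i)) (r i) + d (r i) (s (nearestOpen (σ i)))  ≤⟨ ℚ.+-mono-≤ (ℚ.≤-reflexive (d-sym _ _)) (reach i) ⟩
      greedyCost i + (optCost i + distToOpen (σ i))        ≡⟨ ℚ.+-assoc (greedyCost i) (optCost i) _ ⟨
      detour distToOpen i                                  ∎

    charges : ∀ j → k × distToOpen j ≤ℚ fibreSum g (detour distToOpen) j
    charges j with load j <? k
    ... | yes j-open = begin
      k × distToOpen j                  ≤⟨ ×-monoʳ-≤ k (distToOpen-≤ j j-open) ⟩
      k × d (s j) (s j)                 ≡⟨ cong (k ×_) (d-self (s j)) ⟩
      k × 0ℚ                            ≡⟨ ×-zeroʳ k ⟩
      0ℚ                                ≤⟨ ∑-nonneg (λ i → when-nonneg (g i ≟ j) (detour-nonneg distToOpen-nonneg i)) ⟩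
      fibreSum g (detour distToOpen) j  ∎
    ... | no j-full = ×-≤-fibreSum (ℕ.≮⇒≥ j-full) (detour-nonneg distToOpen-nonneg)
                        (λ { i refl → distToOpen-≤-detour i })

    potential : Potential distToOpen
    potential = record { nonneg = distToOpen-nonneg ; covers = covers ; charges = charges }

  potential-exists : IsGreedyRun μ s r k g → ∃ Potential
  potential-exists greedy with any? (λ j → load j <? k)
  ... | yes (j₀ , j₀-open) = _ , NearestOpen.potential greedy j₀ j₀-open
  ... | no no-open         = _ , saturated-potential (λ j → ℕ.≮⇒≥ (no-open ∘ (j ,_)))

lemma6 : (k : ℕ) → 3 ≤ k →
    {M : Set} (μ : Metric M) (m n : ℕ) (s : Fin m → M) (r : Fin n → M) →
    (g : Fin n → Fin m) → IsGreedyRun μ s r k g →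
    (σ : Fin n → Fin m) → Injective _≡_ _≡_ σ →
    ((+ (k ∸ 2)) / 1) * cost μ s r g ≤ℚ ((+ k) / 1) * cost μ s r σ
lemma6 k@(suc (suc K)) (s≤s (s≤s _)) μ m n s r g greedy σ σ-inj = begin
  (+ K / 1) * cost μ s r g  ≡⟨ k/1*p≡k×p K _ ⟩
  K × cost μ s r g          ≤⟨ ratio-bound K (∑greedy≤∑opt+∑ σ-inj E-pot) (k×∑≤∑greedy+∑opt+∑ σ-inj E-pot) ⟩
  k × cost μ s r σ          ≡⟨ k/1*p≡k×p k _ ⟨
  (+ k / 1) * cost μ s r σ  ∎
  where
  open Charging μ s r k g σ
  E-pot = proj₂ (potential-exists greedy)
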